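{- Let $p,u$ be PPC_dB terms, $n\in\mathbb N$, $\theta$ a list of $n$ fresh symbols, and $V,M$ lists of lists of distinct symbols for which the translations below are defined. Then: (1) if $\{p/u\}_n=\sigma$ is a substitution, then $\mathcal U_{V,M}(\{p/u\}_n)_\theta=\mathcal U_{V,M}(\sigma)_\theta$; (2) if $\{p/u\}_n=\mathtt{fail}$, then $\mathcal U_{V,M}(\{p/u\}_n)_\theta=\mathtt{fail}$; (3) if $\{p/u\}_n=\mathtt{wait}$, then $\mathcal U_{V,M}(\{p/u\}_n)_\theta=\mathtt{wait}$.
   Context: **Matches.** A match is a substitution, $\mathtt{fail}$ or $\mathtt{wait}$. $\mu\uplus\mu'$ is $\mathtt{fail}$ if either match is $\mathtt{fail}$; else $\mathtt{wait}$ if either is $\mathtt{wait}$; else $\mathtt{fail}$ if the domains intersect; else the union. **PPC.** PPC terms: $t::=x\mid\hat x\mid t\,t\mid\lambda_\theta p.s$. Data structures are $d::=\hat x\mid d\,t$; matchable forms are $m::=d\mid\lambda_\theta t.t$. PPC matching $\{p/u\}_\theta$ (first applicable clause): 1. $\{\hat x/u\}_\theta=\{x\mapsto u\}$ if $x\in\theta$; 2. $\{\hat x/\hat x\}_\theta=\{\}$ if $x\notin\theta$; 3. $\{p\,q/t\,u\}_\theta=\{p/t\}_\theta\uplus\{q/u\}_\theta$ if both are matchable forms; 4. $\mathtt{fail}$ if $p,u$ are matchable forms; 5. $\mathtt{wait}$ otherwise. A substitution result whose domain is not $\theta$ becomes $\mathtt{fail}$. **PPC_dB.** PPC_dB terms: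 $t::=\mathsf v_{i,j}\mid\mathsf m_{i,j}\mid t\,t\mid\lambda_np.s$. Data structures are $d::=\mathsf m_{i,j}\mid d\,t$; matchable forms are $m::=d\mid\lambda_nt.t$. PPC_dB matching $\{p/u\}_n$: $\{\mathsf m_{1,j}/u\}_n=\{\mathsf v_{1,j}\mapsto u\}$; $\{\mathsf m_{i+1,j}/\mathsf m_{i,j}\}_n=\{\}$; then the application, $\mathtt{fail}$ and $\mathtt{wait}$ clauses as in PPC. A substitution result whose domain is not $\{\mathsf v_{1,1},\dots,\mathsf v_{1,n}\}$ becomes $\mathtt{fail}$. **Backward translation.** For lists of lists of symbols ($V_{ij}$ is the $j$-th element of the $i$-th list; $\theta++V=[\theta]++V$): - $\mathcal U_{V,M}(\mathsf v_{i,j})=V_{ij}$ and $\mathcal U_{V,M}(\mathsf m_{i,j})=\widehat{M_{ij}}$; - homomorphic on applications; - $\mathcal U_{V,M}(\lambda_np.s)=\lambda_{\theta'}\mathcal U_{V,\theta'++M}(p).\mathcal U_{\theta'++V,M}(s)$, with $\theta'$ a list of $n$ fresh symbols. Translations of substitutions and matches: - For a substitution $\sigma$ at level $1$ and a list $\theta$ with $|\theta|\ge\max\{j\mid\mathsf v_{1,j}\in dom(\sigma)\}$: $\mathcal U_{V,M}(\sigma)_\theta=\{\theta_j\mapsto\mathcal U_{V,M}(\sigma(\mathsf v_{1,j}))\}_{\mathsf v_{1,j}\in dom(\sigma)}$. - For $\theta$ a list of $n$ fresh symbols: $\mathcal U_{V,M}(\{p/u\}_n)_\theta:=\{\mathcal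 U_{V,\theta++M}(p)/\mathcal U_{V,M}(u)\}_\theta$, a PPC matching. -}

module Defs where

open import Data.Nat using (ℕ; zero; suc; _+_; _⊔_; _≡ᵇ_)
open import Data.Bool using (Bool; true; false; _∧_; _∨_; if_then_else_)
open import Data.List using (List; []; _∷_; _++_; map; concat; foldr; upTo)
open import Data.Bool.ListAction using (any; all)
open import Data.Unit using (⊤)
open import Data.Empty using (⊥)
open import Data.Maybe using (Maybe; just; nothing)
open import Data.Product using (_×_; _,_; proj₁)
open import Relation.Binary.PropositionalEquality using (_≡_)

Sym : Set
Sym = ℕ

elemᵇ : ℕ → List ℕ → Bool
elemᵇ x xs = any (λ y → x ≡ᵇ y) xs

data Match (S : Set) : Set where
  fail : Match S
  wait : Match S
  sub  : S → Match S

lookupK : {A : Set} → List (ℕ × A) → ℕ → Maybe A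
lookupK []             x = nothing
lookupK ((k , a) ∷ s)  x = if x ≡ᵇ k then just a else lookupK s x

keys : {A : Set} → List (ℕ × A) → List ℕ
keys = map proj₁

_⊎M_ : {A : Set} → Match (List (ℕ × A)) → Match (List (ℕ × A)) → Match (List (ℕ × A))
fail  ⊎M _      = fail
wait  ⊎M fail   = fail
wait  ⊎M _      = wait
sub s ⊎M fail   = fail
sub s ⊎M wait   = wait
sub s ⊎M sub t  =
  if any (λ k → elemᵇ k (keys t)) (keys s) then fail else sub (s ++ t)

_≈M_ : {A : Set} → Match (List (ℕ × A)) → Match (List (ℕ × A)) → Set
fail  ≈M fail  = ⊤
wait  ≈M wait  = ⊤
sub s ≈M sub t = ∀ x → lookupK s x ≡ lookupK t x
_     ≈M _     = ⊥

data Term : Set where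
  var : Sym → Term
  mat : Sym → Term
  app : Term → Term → Term
  lam : List Sym → Term → Term → Term

PSub : Set
PSub = List (Sym × Term)

isDataP : Term → Bool
isDataP (mat x)   = true
isDataP (app d t) = isDataP d
isDataP _         = false

isMatchableP : Term → Bool
isMatchableP (lam θ p s) = true
isMatchableP t           = isDataP t

dfltP : Term → Term → Match PSub
dfltP p u = if isMatchableP p ∧ isMatchableP u then fail else wait

rawP : List Sym → Term → Term → Match PSub
rawP θ (mat x) u =
  if elemᵇ x θ then sub ((x , u) ∷ []) else matX u
  where
  matX : Term → Match PSub
  matX (mat y) = if x ≡ᵇ y then sub [] else dfltP (mat x) (mat y)
  matX u'      = dfltP (mat x) u'
rawP θ (app p q) (app t u) =
  if isMatchableP (app p q) ∧ isMatchableP (app t u)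
  then rawP θ p t ⊎M rawP θ q u
  else dfltP (app p q) (app t u)
rawP θ p u = dfltP p u

domIs : {A : Set} → List (ℕ × A) → List ℕ → Bool
domIs s θ = all (λ k → elemᵇ k θ) (keys s) ∧ all (λ x → elemᵇ x (keys s)) θ

checkDom : {A : Set} → List ℕ → Match (List (ℕ × A)) → Match (List (ℕ × A))
checkDom θ (sub s) = if domIs s θ then sub s else fail
checkDom θ m       = m

ppcMatch : List Sym → Term → Term → Match PSub
ppcMatch θ p u = checkDom θ (rawP θ p u)

-- PPC_dB terms.  Indices are 0-based: dvar i j stands for v_{i+1,j+1},
-- dmat i j for m_{i+1,j+1}.

data DB : Set where
  dvar : ℕ → ℕ → DB
  dmat : ℕ → ℕ → DB
  dapp : DB → DB → DB
  dlam : ℕ → DB → DB → DB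

-- a level-1 substitution: (j , t) means v_{1,j+1} ↦ t
DSub : Set
DSub = List (ℕ × DB)

isDataD : DB → Bool
isDataD (dmat i j)  = true
isDataD (dapp d t)  = isDataD d
isDataD _           = false

isMatchableD : DB → Bool
isMatchableD (dlam n p s) = true
isMatchableD t            = isDataD t

dfltD : DB → DB → Match DSub
dfltD p u = if isMatchableD p ∧ isMatchableD u then fail else wait

rawD : DB → DB → Match DSub
rawD (dmat zero j) u = sub ((j , u) ∷ [])
rawD (dmat (suc i) j) (dmat i' j') =
  if (i ≡ᵇ i') ∧ (j ≡ᵇ j') then sub [] else dfltD (dmat (suc i) j) (dmat i' j')
rawD (dapp p q) (dapp t u) =
  if isMatchableD (dapp p q) ∧ isMatchableD (dapp t u)
  then rawD p t ⊎M rawD q u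
  else dfltD (dapp p q) (dapp t u)
rawD p u = dfltD p u

dbMatch : ℕ → DB → DB → Match DSub
dbMatch n p u = checkDom (upTo n) (rawD p u)

nth : {A : Set} → List A → ℕ → Maybe A
nth []       _       = nothing
nth (x ∷ xs) zero    = just x
nth (x ∷ xs) (suc k) = nth xs k

nth2 : List (List Sym) → ℕ → ℕ → Maybe Sym
nth2 V i j with nth V i
... | just Vi  = nth Vi j
... | nothing  = nothing

maxSym : List (List Sym) → List (List Sym) → ℕ
maxSym V M = foldr _⊔_ 0 (concat V ++ concat M)

-- deterministic choice of n fresh symbols (all larger than any symbol in V, M)
freshSyms : ℕ → List (List Sym) → List (List Sym) → List Sym
freshSyms n V M = map (λ k → suc (maxSym V M + k)) (upTo n)

mapMaybe : {A B : Set} → (A → B) → Maybe A → Maybe B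
mapMaybe f (just a) = just (f a)
mapMaybe f nothing  = nothing

map2Maybe : {A B C : Set} → (A → B → C) → Maybe A → Maybe B → Maybe C
map2Maybe f (just a) (just b) = just (f a b)
map2Maybe f _        _        = nothing

U : List (List Sym) → List (List Sym) → DB → Maybe Term
U V M (dvar i j)   = mapMaybe var (nth2 V i j)
U V M (dmat i j)   = mapMaybe mat (nth2 M i j)
U V M (dapp s t)   = map2Maybe app (U V M s) (U V M t)
U V M (dlam n p s) =
  map2Maybe (lam θ') (U V (θ' ∷ M) p) (U (θ' ∷ V) M s)
  where θ' = freshSyms n V M

Usub : List (List Sym) → List (List Sym) → DSub → List Sym → Maybe PSub
Usub V M []             θ = just []
Usub V M ((j , t) ∷ σ)  θ =
  map2Maybe _∷_ (map2Maybe _,_ (nth θ j) (U V M t)) (Usub V M σ θ)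

module Submission where

-- The backward translation U is a partial function; we replace it
-- by its inductive graph `Translates`, which preserves data structures and
-- matchable forms.  De Bruijn matching and named matching are then compared
-- clause by clause through a relation `Corr` on their results: both fail, both
-- wait, or the named substitution is the translation of the de Bruijn one.
-- The only non-structural steps are Boolean tests: membership of the pattern
-- symbol in θ (decided by freshness of θ), the comparison of m_{i,j} with
-- m_{i',j'} (agreeing with the comparison of their names since the symbols of M
-- are distinct), and the domain tests in ⊎ and in the final domain check.  The
-- latter compare de Bruijn indices with symbols related by "the j-th element
-- of θ", a partial bijection because θ has no duplicates, and membership tests
-- are invariant under partial bijections (module `Transport`).

open import Defs
open import Data.Nat using (ℕ; zero; suc; _≡ᵇ_)
open import Data.Nat.Properties using (≡ᵇ⇒≡; ≡⇒≡ᵇ)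
open import Data.Bool using (true; false; _∧_; T)
open import Data.Bool.Properties using (T-∧)
open import Data.Bool.ListAction using (and; or; any)
open import Data.List using (List; []; _∷_; _++_; map; length; concat; upTo; applyUpTo)
open import Data.List.Membership.Propositional using (_∈_; _∉_)
open import Data.List.Membership.Propositional.Properties using (∈-++⁺ˡ; ∈-++⁺ʳ)
import Data.List.Relation.Unary.Any as Any
open import Data.List.Relation.Unary.Any using (here; there)
open import Data.List.Relation.Unary.Any.Properties using (any⁺; any⁻)
import Data.List.Relation.Unary.All as All
open import Data.List.Relation.Unary.All.Properties using (++⁻ˡ)
open import Data.List.Relation.Unary.AllPairs using ([]; _∷_)
open import Data.List.Relation.Unary.Unique.Propositional using (Unique)
open import Data.List.Relation.Binary.Pointwise using (Pointwise; []; _∷_; symmetric)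
open import Data.Maybe using (Maybe; just)
open import Data.Maybe.Properties using (just-injective)
open import Data.Product using (Σ; _×_; _,_; proj₂)
open import Data.Empty using (⊥; ⊥-elim)
open import Data.Unit using (tt)
open import Function using (Equivalence)
open import Relation.Binary.PropositionalEquality using (_≡_; refl; sym; trans; cong; cong₂)

map2Maybe-just : {A B C : Set} (f : A → B → C) (a : Maybe A) (b : Maybe B) {c : C} →
  map2Maybe f a b ≡ just c →
  Σ A λ a' → Σ B λ b' → a ≡ just a' × b ≡ just b' × c ≡ f a' b'
map2Maybe-just f (just a) (just b) refl = a , b , refl , refl , refl

mapMaybe-just : {A B : Set} (f : A → B) (a : Maybe A) {c : B} →
  mapMaybe f a ≡ just c → Σ A λ a' → a ≡ just a' × c ≡ f a'
mapMaybe-just f (just a) refl = a , refl , refl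

T-ext : ∀ {b c} → (T b → T c) → (T c → T b) → b ≡ c
T-ext {true}  {true}  _ _ = refl
T-ext {false} {false} _ _ = refl
T-ext {true}  {false} f _ = ⊥-elim (f tt)
T-ext {false} {true}  _ g = ⊥-elim (g tt)

elemᵇ⇒∈ : ∀ {x} xs → T (elemᵇ x xs) → x ∈ xs
elemᵇ⇒∈ {x} xs t = Any.map (≡ᵇ⇒≡ x _) (any⁻ _ xs t)

∈⇒elemᵇ : ∀ {x xs} → x ∈ xs → T (elemᵇ x xs)
∈⇒elemᵇ {x} m = any⁺ _ (Any.map (≡⇒≡ᵇ x _) m)

∈⇒elemᵇ≡true : ∀ {x xs} → x ∈ xs → elemᵇ x xs ≡ true
∈⇒elemᵇ≡true m = T-ext _ (λ _ → ∈⇒elemᵇ m)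

∉⇒elemᵇ≡false : ∀ {x xs} → x ∉ xs → elemᵇ x xs ≡ false
∉⇒elemᵇ≡false {xs = xs} x∉ = T-ext (λ t → x∉ (elemᵇ⇒∈ xs t)) λ ()

map-pointwise : {A B C : Set} {R : A → B → Set} (f : A → C) (g : B → C) →
  (∀ {a b} → R a b → f a ≡ g b) →
  ∀ {xs ys} → Pointwise R xs ys → map f xs ≡ map g ys
map-pointwise f g agree []       = refl
map-pointwise f g agree (r ∷ rs) = cong₂ _∷_ (agree r) (map-pointwise f g agree rs)

∈-pointwise : {R : ℕ → ℕ → Set} → (∀ {a b b'} → R a b → R a b' → b ≡ b') →
  ∀ {x y xs ys} → Pointwise R xs ys → R x y → x ∈ xs → y ∈ ys
∈-pointwise functional (r ∷ rs) rxy (here refl) = here (functional rxy r)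
∈-pointwise functional (r ∷ rs) rxy (there m)   = there (∈-pointwise functional rs rxy m)

-- Boolean membership tests are invariant under a partial bijection R on
-- symbols; this covers the disjointness test of ⊎ and the domain check.
module Transport {R : ℕ → ℕ → Set}
  (functional : ∀ {a b b'} → R a b → R a b' → b ≡ b')
  (injective  : ∀ {a a' b} → R a b → R a' b → a ≡ a') where

  elemᵇ-transport : ∀ {x y xs ys} → Pointwise R xs ys → R x y → elemᵇ x xs ≡ elemᵇ y ys
  elemᵇ-transport {xs = xs} {ys} rs rxy = T-ext
    (λ t → ∈⇒elemᵇ (∈-pointwise functional rs rxy (elemᵇ⇒∈ xs t)))
    (λ t → ∈⇒elemᵇ (∈-pointwise injective (symmetric (λ r → r) rs) rxy (elemᵇ⇒∈ ys t)))

  clash-transport : {A B : Set} {s t : List (ℕ × A)} {s' t' : List (ℕ × B)} →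
    Pointwise R (keys s) (keys s') → Pointwise R (keys t) (keys t') →
    any (λ k → elemᵇ k (keys t)) (keys s) ≡ any (λ k → elemᵇ k (keys t')) (keys s')
  clash-transport ks kt = cong or (map-pointwise _ _ (λ r → elemᵇ-transport kt r) ks)

  domIs-transport : {A B : Set} {s : List (ℕ × A)} {s' : List (ℕ × B)} {ds ds' : List ℕ} →
    Pointwise R (keys s) (keys s') → Pointwise R ds ds' → domIs s ds ≡ domIs s' ds'
  domIs-transport ks rs = cong₂ _∧_
    (cong and (map-pointwise _ _ (λ r → elemᵇ-transport rs r) ks))
    (cong and (map-pointwise _ _ (λ r → elemᵇ-transport ks r) rs))

At : List ℕ → ℕ → ℕ → Set
At xs j x = nth xs j ≡ just x

nth-∈ : ∀ (xs : List ℕ) k {x} → At xs k x → x ∈ xs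
nth-∈ (a ∷ xs) zero    refl = here refl
nth-∈ (a ∷ xs) (suc k) e    = there (nth-∈ xs k e)

nth-injective : ∀ (xs : List ℕ) → Unique xs → ∀ {k l x} → At xs k x → At xs l x → k ≡ l
nth-injective (a ∷ xs) u       {zero}  {zero}  e₁   e₂   = refl
nth-injective (a ∷ xs) (h ∷ u) {zero}  {suc l} refl e₂   = ⊥-elim (All.lookup h (nth-∈ xs l e₂) refl)
nth-injective (a ∷ xs) (h ∷ u) {suc k} {zero}  e₁   refl = ⊥-elim (All.lookup h (nth-∈ xs k e₁) refl)
nth-injective (a ∷ xs) (h ∷ u) {suc k} {suc l} e₁   e₂   = cong suc (nth-injective xs u e₁ e₂)

applyUpTo-At : (θ xs : List ℕ) (f : ℕ → ℕ) → (∀ i → nth θ (f i) ≡ nth xs i) →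
  Pointwise (At θ) (applyUpTo f (length xs)) xs
applyUpTo-At θ []       f shift = []
applyUpTo-At θ (a ∷ xs) f shift =
  shift 0 ∷ applyUpTo-At θ xs (λ i → f (suc i)) (λ i → shift (suc i))

upTo-At : (θ : List ℕ) → Pointwise (At θ) (upTo (length θ)) θ
upTo-At θ = applyUpTo-At θ θ (λ i → i) (λ i → refl)

unique-++ˡ : ∀ (xs ys : List ℕ) → Unique (xs ++ ys) → Unique xs
unique-++ˡ []       ys u       = []
unique-++ˡ (a ∷ xs) ys (h ∷ u) = ++⁻ˡ xs h ∷ unique-++ˡ xs ys u

unique-++ʳ : ∀ (xs ys : List ℕ) → Unique (xs ++ ys) → Unique ys
unique-++ʳ []       ys u       = u
unique-++ʳ (a ∷ xs) ys (_ ∷ u) = unique-++ʳ xs ys u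

unique-++-disjoint : ∀ (xs ys : List ℕ) → Unique (xs ++ ys) → ∀ {x} → x ∈ xs → x ∈ ys → ⊥
unique-++-disjoint (a ∷ xs) ys (h ∷ u) (here refl) y = All.lookup h (∈-++⁺ʳ xs y) refl
unique-++-disjoint (a ∷ xs) ys (h ∷ u) (there m)   y = unique-++-disjoint xs ys u m y

nth2-∈ : ∀ M i j {x} → nth2 M i j ≡ just x → x ∈ concat M
nth2-∈ (m ∷ M) zero    j e = ∈-++⁺ˡ (nth-∈ m j e)
nth2-∈ (m ∷ M) (suc i) j e = ∈-++⁺ʳ m (nth2-∈ M i j e)

nth2-injective : ∀ M → Unique (concat M) → ∀ i j i' j' {x} →
  nth2 M i j ≡ just x → nth2 M i' j' ≡ just x → i ≡ i' × j ≡ j'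
nth2-injective (m ∷ M) u zero j zero j' e₁ e₂ =
  refl , nth-injective m (unique-++ˡ m _ u) e₁ e₂
nth2-injective (m ∷ M) u zero j (suc i') j' e₁ e₂ =
  ⊥-elim (unique-++-disjoint m _ u (nth-∈ m j e₁) (nth2-∈ M i' j' e₂))
nth2-injective (m ∷ M) u (suc i) j zero j' e₁ e₂ =
  ⊥-elim (unique-++-disjoint m _ u (nth-∈ m j' e₂) (nth2-∈ M i j e₁))
nth2-injective (m ∷ M) u (suc i) j (suc i') j' e₁ e₂
  with nth2-injective M (unique-++ʳ m _ u) i j i' j' e₁ e₂
... | refl , j≡j' = refl , j≡j'

index-test≡name-test : ∀ M → Unique (concat M) → ∀ i j i' j' {x y} →
  nth2 M i j ≡ just x → nth2 M i' j' ≡ just y → ((i ≡ᵇ i') ∧ (j ≡ᵇ j')) ≡ (x ≡ᵇ y)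
index-test≡name-test M u i j i' j' {x} {y} e e' = T-ext same-index⇒same-name same-name⇒same-index
  where
  same-index⇒same-name : T ((i ≡ᵇ i') ∧ (j ≡ᵇ j')) → T (x ≡ᵇ y)
  same-index⇒same-name t with Equivalence.to T-∧ t
  ... | ti , tj with ≡ᵇ⇒≡ i i' ti | ≡ᵇ⇒≡ j j' tj
  ... | refl | refl = ≡⇒≡ᵇ x y (just-injective (trans (sym e) e'))

  same-name⇒same-index : T (x ≡ᵇ y) → T ((i ≡ᵇ i') ∧ (j ≡ᵇ j'))
  same-name⇒same-index t with ≡ᵇ⇒≡ x y t
  ... | refl with nth2-injective M u i j i' j' e e'
  ... | i≡i' , j≡j' = Equivalence.from T-∧ (≡⇒≡ᵇ i i' i≡i' , ≡⇒≡ᵇ j j' j≡j')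

data Translates (V M : List (List Sym)) : DB → Term → Set where
  var : ∀ {i j x} → nth2 V i j ≡ just x → Translates V M (dvar i j) (var x)
  mat : ∀ {i j x} → nth2 M i j ≡ just x → Translates V M (dmat i j) (mat x)
  app : ∀ {s t s' t'} → Translates V M s s' → Translates V M t t' →
        Translates V M (dapp s t) (app s' t')
  lam : ∀ {n p s p' s'} →
        U V (freshSyms n V M ∷ M) p ≡ just p' → U (freshSyms n V M ∷ V) M s ≡ just s' →
        Translates V M (dlam n p s) (lam (freshSyms n V M) p' s')

toTranslates : ∀ V M d {t} → U V M d ≡ just t → Translates V M d t
toTranslates V M (dvar i j) e with mapMaybe-just var (nth2 V i j) e
... | x , ex , refl = var ex
toTranslates V M (dmat i j) e with mapMaybe-just mat (nth2 M i j) e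
... | x , ex , refl = mat ex
toTranslates V M (dapp s t) e with map2Maybe-just app (U V M s) (U V M t) e
... | s' , t' , es , et , refl = app (toTranslates V M s es) (toTranslates V M t et)
toTranslates V M (dlam n p s) e
  with map2Maybe-just (lam (freshSyms n V M)) (U V (freshSyms n V M ∷ M) p)
                      (U (freshSyms n V M ∷ V) M s) e
... | p' , s' , ep , es , refl = lam ep es

fromTranslates : ∀ {V M d t} → Translates V M d t → U V M d ≡ just t
fromTranslates (var e)   rewrite e = refl
fromTranslates (mat e)   rewrite e = refl
fromTranslates (app a b) rewrite fromTranslates a | fromTranslates b = refl
fromTranslates (lam ep es) rewrite ep | es = refl

isData-preserved : ∀ {V M d t} → Translates V M d t → isDataD d ≡ isDataP t
isData-preserved (var _)   = refl
isData-preserved (mat _)   = refl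
isData-preserved (app a _) = isData-preserved a
isData-preserved (lam _ _) = refl

isMatchable-preserved : ∀ {V M d t} → Translates V M d t → isMatchableD d ≡ isMatchableP t
isMatchable-preserved (var _)   = refl
isMatchable-preserved (mat _)   = refl
isMatchable-preserved (app a _) = isData-preserved a
isMatchable-preserved (lam _ _) = refl

module Correspondence (θ : List Sym) (V M : List (List Sym)) where

  data Corr : Match DSub → Match PSub → Set where
    both-fail  : Corr fail fail
    both-wait  : Corr wait wait
    translated : ∀ {σ τ} → Usub V M σ θ ≡ just τ → Corr (sub σ) (sub τ)

  -- Clauses 4-5 (fail / wait) agree, as they only inspect matchable forms.
  Corr-default : ∀ {V' M' p tp u tu} → Translates V' M' p tp → Translates V M u tu →
    Corr (dfltD p u) (dfltP tp tu)
  Corr-default {tp = tp} {tu = tu} a b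
    rewrite isMatchable-preserved a | isMatchable-preserved b
    with isMatchableP tp ∧ isMatchableP tu
  ... | true  = both-fail
  ... | false = both-wait

  keys-At : ∀ σ {τ} → Usub V M σ θ ≡ just τ → Pointwise (At θ) (keys σ) (keys τ)
  keys-At [] refl = []
  keys-At ((j , t) ∷ σ) e
    with map2Maybe-just _∷_ (map2Maybe _,_ (nth θ j) (U V M t)) (Usub V M σ θ) e
  ... | _ , τ , e-head , e-tail , refl
    with map2Maybe-just _,_ (nth θ j) (U V M t) e-head
  ... | x , _ , ex , _ , refl = ex ∷ keys-At σ e-tail

  Usub-++ : ∀ s t {s' t'} → Usub V M s θ ≡ just s' → Usub V M t θ ≡ just t' →
    Usub V M (s ++ t) θ ≡ just (s' ++ t')
  Usub-++ [] t refl et = et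
  Usub-++ ((j , v) ∷ s) t es et
    with map2Maybe-just _∷_ (map2Maybe _,_ (nth θ j) (U V M v)) (Usub V M s θ) es
  ... | _ , _ , e-head , e-tail , refl rewrite e-head | Usub-++ s t e-tail et = refl

  Usub-singleton : ∀ {j x u tu} → At θ j x → U V M u ≡ just tu →
    Usub V M ((j , u) ∷ []) θ ≡ just ((x , tu) ∷ [])
  Usub-singleton ex eu rewrite ex | eu = refl

  module _ (uθ : Unique θ) where

    open Transport {At θ} (λ e e' → just-injective (trans (sym e) e')) (nth-injective θ uθ)

    -- ⊎ preserves the correspondence: its disjointness test agrees on both sides.
    Corr-⊎ : ∀ {μ₁ ν₁ μ₂ ν₂} → Corr μ₁ ν₁ → Corr μ₂ ν₂ → Corr (μ₁ ⊎M μ₂) (ν₁ ⊎M ν₂)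
    Corr-⊎ both-fail      _              = both-fail
    Corr-⊎ both-wait      both-fail      = both-fail
    Corr-⊎ both-wait      both-wait      = both-wait
    Corr-⊎ both-wait      (translated _) = both-wait
    Corr-⊎ (translated _) both-fail      = both-fail
    Corr-⊎ (translated _) both-wait      = both-wait
    Corr-⊎ (translated {s} {s'} es) (translated {t} {t'} et)
      rewrite clash-transport {s = s} {t} {s'} {t'} (keys-At s es) (keys-At t et)
      with any (λ k → elemᵇ k (keys t')) (keys s')
    ... | true  = both-fail
    ... | false = translated (Usub-++ s t es et)

    Corr-checkDom : ∀ {μ ν} → Corr μ ν → Corr (checkDom (upTo (length θ)) μ) (checkDom θ ν)
    Corr-checkDom both-fail = both-fail
    Corr-checkDom both-wait = both-wait
    Corr-checkDom (translated {σ} {τ} e)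
      rewrite domIs-transport {s = σ} {τ} (keys-At σ e) (upTo-At θ)
      with domIs τ θ
    ... | true  = translated e
    ... | false = both-fail

  module _ (uθ : Unique θ) (fresh : ∀ x → x ∈ θ → x ∉ concat M) (uM : Unique (concat M)) where

    outside-θ : ∀ i j {x} → nth2 M i j ≡ just x → x ∉ θ
    outside-θ i j e x∈θ = fresh _ x∈θ (nth2-∈ M i j e)

    Corr-raw : ∀ {p tp u tu} → Translates V (θ ∷ M) p tp → Translates V M u tu →
      Corr (rawD p u) (rawP θ tp tu)
    Corr-raw a@(var _)   b = Corr-default a b
    Corr-raw a@(lam _ _) b = Corr-default a b
    Corr-raw {dmat zero j} {mat x} {u} (mat e) b
      rewrite ∈⇒elemᵇ≡true (nth-∈ θ j e) = translated (Usub-singleton {u = u} e (fromTranslates b))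
    Corr-raw {dmat (suc i) j} {mat x} {dmat i' j'} {mat y} (mat e) (mat e')
      rewrite ∉⇒elemᵇ≡false (outside-θ i j e) | index-test≡name-test M uM i j i' j' e e'
      with x ≡ᵇ y
    ... | true  = translated refl
    ... | false = both-fail
    Corr-raw {dmat (suc i) j} {mat x} a@(mat e) b@(var _)
      rewrite ∉⇒elemᵇ≡false (outside-θ i j e) = Corr-default a b
    Corr-raw {dmat (suc i) j} {mat x} a@(mat e) b@(app _ _)
      rewrite ∉⇒elemᵇ≡false (outside-θ i j e) = Corr-default a b
    Corr-raw {dmat (suc i) j} {mat x} a@(mat e) b@(lam _ _)
      rewrite ∉⇒elemᵇ≡false (outside-θ i j e) = Corr-default a b
    Corr-raw a@(app _ _) b@(var _)   = Corr-default a b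
    Corr-raw a@(app _ _) b@(mat _)   = Corr-default a b
    Corr-raw a@(app _ _) b@(lam _ _) = Corr-default a b
    Corr-raw (app {s' = tp} a₁ a₂) (app {s' = tu} b₁ b₂)
      rewrite isData-preserved a₁ | isData-preserved b₁
      with isDataP tp ∧ isDataP tu
    ... | true  = Corr-⊎ uθ (Corr-raw a₁ b₁) (Corr-raw a₂ b₂)
    ... | false = both-wait

Corr-sub : ∀ {θ V M μ ν} → Correspondence.Corr θ V M μ ν →
  ∀ σ → μ ≡ sub σ → ∀ τ → Usub V M σ θ ≡ just τ → ν ≈M sub τ
Corr-sub (Correspondence.translated e) σ refl τ e' with trans (sym e) e'
... | refl = λ x → refl

Corr-fail : ∀ {θ V M μ ν} → Correspondence.Corr θ V M μ ν → μ ≡ fail → ν ≡ fail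
Corr-fail Correspondence.both-fail refl = refl

Corr-wait : ∀ {θ V M μ ν} → Correspondence.Corr θ V M μ ν → μ ≡ wait → ν ≡ wait
Corr-wait Correspondence.both-wait refl = refl

lemma4p10 : (p u : DB) (n : ℕ) (θ : List Sym) (V M : List (List Sym)) (tp tu : Term) →
    length θ ≡ n → Unique θ →
    (∀ x → x ∈ θ → (x ∉ concat V) × (x ∉ concat M)) →
    Unique (concat V) → Unique (concat M) →
    U V (θ ∷ M) p ≡ just tp → U V M u ≡ just tu →
    ((σ : DSub) → dbMatch n p u ≡ sub σ →
       (τ : PSub) → Usub V M σ θ ≡ just τ → ppcMatch θ tp tu ≈M sub τ)
    × (dbMatch n p u ≡ fail → ppcMatch θ tp tu ≡ fail)
    × (dbMatch n p u ≡ wait → ppcMatch θ tp tu ≡ wait)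
lemma4p10 p u .(length θ) θ V M tp tu refl uθ fresh _ uM ep eu =
  Corr-sub matches-correspond , Corr-fail matches-correspond , Corr-wait matches-correspond
  where
  open Correspondence θ V M
  fresh-for-M : ∀ x → x ∈ θ → x ∉ concat M
  fresh-for-M x x∈θ = proj₂ (fresh x x∈θ)

  matches-correspond : Corr (dbMatch (length θ) p u) (ppcMatch θ tp tu)
  matches-correspond = Corr-checkDom uθ
    (Corr-raw uθ fresh-for-M uM (toTranslates V (θ ∷ M) p ep) (toTranslates V M u eu))
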